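{- Let $n$ be an odd integer with $n>1$ and let $A=U(n)$. Suppose $S:(x_1,\ldots,x_\ell)$ is an $A$-extremal sequence in $\mathbb{Z}_n$, and let $k+1=(\ell+1)/2$. Then there is a prime divisor $p$ of $n$ such that $p$ divides every term of $S$ other than $x_{k+1}$ and $p$ does not divide $x_{k+1}$. Moreover, let $n'=n/p$, $A'=U(n')$, $S_1:(x_1,\ldots,x_k)$, $S_2:(x_{k+2},\ldots,x_\ell)$, and let $S_1',S_2'$ be the sequences in $\mathbb{Z}_{n'}$ obtained by dividing the terms of $S_1$ and $S_2$ by $p$. Then $S_1'$ and $S_2'$ are $A'$-extremal sequences in $\mathbb{Z}_{n'}$.
   Context: For an integer $m\ge 1$, $\mathbb{Z}_m=\mathbb{Z}/m\mathbb{Z}$ and $U(m)$ is its group of units. For $B\subseteq\mathbb{Z}_m\setminus\{0\}$, a sequence $(x_1,\ldots,x_k)$ ($k\ge1$) in $\mathbb{Z}_m$ is a $B$-weighted zero-sum sequence if there exist $b_1,\ldots,b_k\in B$ with $b_1x_1+\cdots+b_kx_k=0$. A subsequence of consecutive terms is a nonempty block $(x_i,\ldots,x_j)$, $1\le i\le j\le k$. $C_B(m)$ is the least positive integer $k$ such that every sequence of length $k$ in $\mathbb{Z}_m$ has a $B$-weighted zero-sum subsequence of consecutive terms. A sequence in $\mathbb{Z}_m$ is $B$-extremal if it has length $C_B(m)-1$ and has no $B$-weighted zero-sum subsequence of consecutive terms. For a prime $p\mid n$, an element $x\in\mathbb{Z}_n$ is divisible by $p$ if its integer representatives are multiples of $p$;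 for such $x$, "dividing $x$ by $p$" gives the element $r/p \bmod n/p$ of $\mathbb{Z}_{n/p}$, where $r$ is any integer representative of $x$ (this is well defined). -}

module Defs where

open import Data.Nat using (ℕ; suc; _*_; _+_; _≤_; _<_)
open import Data.Nat.Divisibility using (_∣_)
open import Data.Nat.Coprimality using (Coprime)
open import Data.Fin using (Fin; toℕ)
open import Data.List using (List; []; _∷_; _++_; length; zipWith)
open import Data.Nat.ListAction using (sum)
open import Data.List.Relation.Unary.All using (All)
open import Data.Product using (Σ; _×_; ∃; ∃-syntax)
open import Relation.Binary.PropositionalEquality using (_≡_; _≢_)
open import Relation.Nullary using (¬_)

-- ℤ_m is represented by Fin m (residues 0..m-1); arithmetic is taken modulo m.
-- The unit group U(m), as a predicate on ℤ_m.
U : (m : ℕ) → Fin m → Set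
U m b = Coprime (toℕ b) m

weightedSum : {m : ℕ} → List (Fin m) → List (Fin m) → ℕ
weightedSum ws xs = sum (zipWith (λ b x → toℕ b * toℕ x) ws xs)

WeightedZeroSum : {m : ℕ} → (Fin m → Set) → List (Fin m) → Set
WeightedZeroSum {m} B xs =
  xs ≢ [] × ∃[ ws ] (length ws ≡ length xs × All B ws × m ∣ weightedSum ws xs)

Block : {A : Set} → List A → List A → Set
Block {A} ys xs = ys ≢ [] × ∃[ pre ] ∃[ suf ] (xs ≡ pre ++ ys ++ suf)

HasZeroSumBlock : {m : ℕ} → (Fin m → Set) → List (Fin m) → Set
HasZeroSumBlock B xs = ∃[ ys ] (Block ys xs × WeightedZeroSum B ys)

AllHaveBlock : (m : ℕ) → (Fin m → Set) → ℕ → Set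
AllHaveBlock m B k = (xs : List (Fin m)) → length xs ≡ k → HasZeroSumBlock B xs

IsC : (m : ℕ) → (Fin m → Set) → ℕ → Set
IsC m B c = 1 ≤ c × AllHaveBlock m B c
          × ((k : ℕ) → 1 ≤ k → k < c → ¬ AllHaveBlock m B k)

Extremal : (m : ℕ) → (Fin m → Set) → List (Fin m) → Set
Extremal m B xs = ∃[ c ] (IsC m B c × suc (length xs) ≡ c) × ¬ HasZeroSumBlock B xs

-- A sequence T of naturals, taken modulo an odd n, is either a U(n)-weighted zero sum or is
-- separated: some divisor q of n divides every term but one.  This goes by induction on the
-- prime factors of n = p * m.  If p divides every term, divide by p.  Otherwise lift a zero sum
-- modulo m to one modulo p * m by raising weights by multiples of m: one term prime to p fixes the
-- sum modulo p when p ∣ m, and when p ∤ m two such terms do, p > 2 leaving room to keep both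
-- raised weights prime to p.
--
-- An extremal S has no zero-sum block, so it is separated by some q.  Reflecting either side of the
-- separating term across it stays zero-sum free, so neither side is longer than k: the separating
-- term is x_{k+1}.  A prime p ∣ q then divides all other terms, and not x_{k+1}, for otherwise S, 1
-- would be zero-sum free of length C(n).  Dividing S₁ and S₂ by p keeps them zero-sum free modulo
-- n / p, and every sequence T of length k + 1 modulo n / p has a zero-sum block, since otherwise
-- p·T, 1, p·T would be zero-sum free modulo n of length 2k + 3.

module Submission where

open import Defs
open import Data.Nat
  using (ℕ; zero; suc; _*_; _+_; _<_; _≤_; z≤n; s≤s; NonZero; >-nonZero; ≢-nonZero; nonTrivial⇒n>1; nonTrivial⇒≢1; _≟_)
open import Data.Nat.Properties
open import Data.Nat.Divisibility
open import Data.Nat.DivMod using (_%_; _/_; _mod_; m≡m%n+[m/n]*n; m%n<n)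
open import Data.Nat.Coprimality
  using (Coprime; coprime-divisor; coprime-Bézout; coprime?; 1-coprimeTo) renaming (sym to coprime-sym)
open import Data.Nat.GCD using (module Bézout)
open import Data.Nat.ListAction using (sum; product)
open import Data.Nat.Primality
  using (Prime; euclidsLemma; prime⇒irreducible; prime⇒nonZero; prime⇒nonTrivial; prime[2])
open import Data.Nat.Primality.Factorisation using (factorise)
open import Data.Nat.Induction using (<-rec)
open import Data.Nat.Solver using (module +-*-Solver)
open import Data.Fin using (Fin; toℕ; fromℕ<)
open import Data.Fin.Properties using (toℕ-fromℕ<; toℕ<n; any?)
open import Data.List using (List; []; _∷_; _++_; length; map; zipWith; replicate; take; drop)
open import Data.List.Properties
  using (length-++; length-map; length-replicate; length-take; map-++; zipWith-map; ++-assoc; ++-identityʳ;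
         ∷-injective; ∷-injectiveʳ; ++-conicalˡ; ++-conicalʳ; take++drop≡id)
open import Data.List.Relation.Unary.All as All using (All; []; _∷_)
import Data.List.Relation.Unary.All.Properties as All
open import Data.List.Relation.Unary.First using (first; FirstView)
open import Data.List.Relation.Unary.First.Properties using (toView)
open import Data.List.Relation.Binary.Pointwise as Pointwise using (Pointwise; []; _∷_; Pointwise-length)
open import Data.Product using (_×_; _,_; ∃-syntax)
open import Data.Sum using (_⊎_; inj₁; inj₂)
open import Data.Empty using (⊥; ⊥-elim)
open import Function using (_∘_)
open import Relation.Binary.Definitions using (Reflexive)
open import Relation.Nullary using (¬_; Dec; yes; no)
open import Relation.Nullary.Decidable using (toSum; _×-dec_)
open import Relation.Binary.PropositionalEquality
open +-*-Solver

prime⇒≥2 : ∀ {p} → Prime p → 2 ≤ p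
prime⇒≥2 {p} pr = nonTrivial⇒n>1 p {{prime⇒nonTrivial pr}}

prime⇒∤1 : ∀ {p} → Prime p → ¬ p ∣ 1
prime⇒∤1 pr p∣1 = nonTrivial⇒≢1 {{prime⇒nonTrivial pr}} (∣1⇒≡1 p∣1)

prime∤⇒coprime : ∀ {p c} → Prime p → ¬ p ∣ c → Coprime c p
prime∤⇒coprime pr p∤c (d∣c , d∣p) with prime⇒irreducible pr d∣p
... | inj₁ d≡1  = d≡1
... | inj₂ refl = ⊥-elim (p∤c d∣c)

prime∤* : ∀ {p a b} → Prime p → ¬ p ∣ a → ¬ p ∣ b → ¬ p ∣ a * b
prime∤* {a = a} {b} pr p∤a p∤b p∣ab with euclidsLemma a b pr p∣ab
... | inj₁ p∣a = p∤a p∣a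
... | inj₂ p∣b = p∤b p∣b

coprime-∣ʳ : ∀ {c m n} → Coprime c n → m ∣ n → Coprime c m
coprime-∣ʳ c⊥n m∣n (d∣c , d∣m) = c⊥n (d∣c , ∣-trans d∣m m∣n)

coprime-*ʳ : ∀ {c a b} → Coprime c a → Coprime c b → Coprime c (a * b)
coprime-*ʳ {a = a} c⊥a c⊥b {d} (d∣c , d∣ab) = c⊥b (d∣c , coprime-divisor d⊥a d∣ab)
  where
  d⊥a : Coprime d a
  d⊥a (e∣d , e∣a) = c⊥a (∣-trans e∣d d∣c , e∣a)

coprime-+-*ˡ : ∀ {c m} s → Coprime c m → Coprime (c + m * s) m
coprime-+-*ˡ {c} {m} s c⊥m {i} (i∣c+ms , i∣m) =
  c⊥m (∣m+n∣m⇒∣n (subst (i ∣_) (+-comm c (m * s)) i∣c+ms) (∣m⇒∣m*n s i∣m) , i∣m)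

coprime-*-∣ : ∀ {a b c} → Coprime a b → a ∣ c → b ∣ c → a * b ∣ c
coprime-*-∣ {a} {b} a⊥b (divides e refl) b∣ea with coprime-divisor (coprime-sym a⊥b) (subst (b ∣_) (*-comm e a) b∣ea)
... | divides f refl = divides f (solve 3 (λ f b a → f :* b :* a := f :* (a :* b)) refl f b a)

coprime-*-prime : ∀ {p w m} → Prime p → ¬ p ∣ w → Coprime w m → Coprime w (p * m)
coprime-*-prime pr p∤w w⊥m = coprime-*ʳ (prime∤⇒coprime pr p∤w) w⊥m

∃-coprime-lift : ∀ {p c m} → Prime p → Coprime c m → ∃[ e ] Coprime (c + m * e) (p * m)
∃-coprime-lift {p} {c} {m} pr c⊥m with p∤c+me
  where
  c+m*0≡c : c + m * 0 ≡ c
  c+m*0≡c = trans (cong (c +_) (*-zeroʳ m)) (+-identityʳ c)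
  p∤c+me : ∃[ e ] ¬ p ∣ c + m * e
  p∤c+me with p ∣? m | p ∣? c
  ... | yes p∣m | _       = 0 , λ p∣c → prime⇒∤1 pr (subst (p ∣_) (c⊥m (subst (p ∣_) c+m*0≡c p∣c , p∣m)) ∣-refl)
  ... | no _    | no p∤c  = 0 , λ p∣c → p∤c (subst (p ∣_) c+m*0≡c p∣c)
  ... | no p∤m  | yes p∣c = 1 , λ p∣c+m → p∤m (subst (p ∣_) (*-identityʳ m) (∣m+n∣m⇒∣n p∣c+m p∣c))
... | e , p∤c+me = e , coprime-*-prime pr p∤c+me (coprime-+-*ˡ e c⊥m)

coprime-% : ∀ {w m} .{{_ : NonZero m}} → Coprime w m → Coprime (w % m) m
coprime-% w⊥m (d∣w%m , d∣m) = w⊥m (∣n∣m%n⇒∣m d∣m d∣w%m , d∣m)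

∃-linear-root : ∀ {p a} → Prime p → ¬ p ∣ a → ∀ c → ∃[ s ] p ∣ c + a * s
∃-linear-root {p} {a} pr p∤a c with coprime-Bézout (prime∤⇒coprime pr p∤a)
... | Bézout.-+ x y eq = x * c , divides (c * y) (begin
  c + a * (x * c) ≡⟨ solve 3 (λ c a x → c :+ a :* (x :* c) := c :* (con 1 :+ x :* a)) refl c a x ⟩
  c * (1 + x * a) ≡⟨ cong (c *_) eq ⟩
  c * (y * p)     ≡⟨ *-assoc c y p ⟨
  c * y * p       ∎)
  where open ≡-Reasoning
-- Here x * a ≡ 1 (mod p), so the root is x * c * (p − 1).
∃-linear-root {suc p′} {a} pr p∤a c | Bézout.+- x y eq = x * (c * p′) , divides (c + y * (c * p′)) (begin
  c + a * (x * (c * p′))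
    ≡⟨ solve 4 (λ c a x p′ → c :+ a :* (x :* (c :* p′)) := c :+ (x :* a) :* (c :* p′)) refl c a x p′ ⟩
  c + (x * a) * (c * p′)
    ≡⟨ cong (λ z → c + z * (c * p′)) eq ⟨
  c + (1 + y * suc p′) * (c * p′)
    ≡⟨ solve 3 (λ c y p′ → c :+ (con 1 :+ y :* (con 1 :+ p′)) :* (c :* p′)
                          := (c :+ y :* (c :* p′)) :* (con 1 :+ p′)) refl c y p′ ⟩
  (c + y * (c * p′)) * suc p′
    ∎)
  where open ≡-Reasoning

linear-roots-∣ : ∀ {p a c s d} → Prime p → ¬ p ∣ a → p ∣ c + a * s → p ∣ c + a * (s + d) → p ∣ d
linear-roots-∣ {p} {a} {c} {s} {d} pr p∤a root root′
  with euclidsLemma a d pr (∣m+n∣m⇒∣n (subst (p ∣_) shift root′) root)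
  where
  shift : c + a * (s + d) ≡ c + a * s + a * d
  shift = solve 4 (λ c a s d → c :+ a :* (s :+ d) := c :+ a :* s :+ a :* d) refl c a s d
... | inj₁ p∣a = ⊥-elim (p∤a p∣a)
... | inj₂ p∣d = p∣d

-- Each form has at most one root among 0, 1, 2 since p > 2; this is where the oddness of n is used.
∃-common-nonroot : ∀ {p a a′} → Prime p → 2 < p → ¬ p ∣ a → ¬ p ∣ a′ → ∀ c c′
                 → ∃[ s ] (¬ p ∣ c + a * s × ¬ p ∣ c′ + a′ * s)
∃-common-nonroot {p} {a} {a′} pr p>2 p∤a p∤a′ c c′ with classify 0 | classify 1 | classify 2
  where
  classify : ∀ s → (¬ p ∣ c + a * s × ¬ p ∣ c′ + a′ * s) ⊎ (p ∣ c + a * s ⊎ p ∣ c′ + a′ * s)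
  classify s with p ∣? c + a * s | p ∣? c′ + a′ * s
  ... | yes r | _     = inj₂ (inj₁ r)
  ... | no _  | yes r = inj₂ (inj₂ r)
  ... | no r  | no r′ = inj₁ (r , r′)
... | inj₁ good | _         | _         = 0 , good
... | inj₂ _    | inj₁ good | _         = 1 , good
... | inj₂ _    | inj₂ _    | inj₁ good = 2 , good
... | inj₂ r₀   | inj₂ r₁   | inj₂ r₂   = ⊥-elim (pigeonhole r₀ r₁ r₂)
  where
  gap : ∀ d → 0 < d → d ≤ 2 → ¬ p ∣ d
  gap d 0<d d≤2 p∣d = <⇒≱ p>2 (≤-trans (∣⇒≤ {{>-nonZero 0<d}} p∣d) d≤2)
  clash : ∀ {a c} → ¬ p ∣ a → ∀ s d → 0 < d → d ≤ 2 → p ∣ c + a * s → ¬ p ∣ c + a * (s + d)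
  clash p∤a s d 0<d d≤2 r r′ = gap d 0<d d≤2 (linear-roots-∣ pr p∤a r r′)
  pigeonhole : _ → _ → _ → ⊥
  pigeonhole (inj₁ r₀) (inj₁ r₁) _         = clash p∤a 0 1 (s≤s z≤n) (s≤s z≤n) r₀ r₁
  pigeonhole (inj₁ r₀) (inj₂ _)  (inj₁ r₂) = clash p∤a 0 2 (s≤s z≤n) ≤-refl r₀ r₂
  pigeonhole (inj₁ _)  (inj₂ r₁) (inj₂ r₂) = clash p∤a′ 1 1 (s≤s z≤n) (s≤s z≤n) r₁ r₂
  pigeonhole (inj₂ r₀) (inj₂ r₁) _         = clash p∤a′ 0 1 (s≤s z≤n) (s≤s z≤n) r₀ r₁
  pigeonhole (inj₂ _)  (inj₁ r₁) (inj₁ r₂) = clash p∤a 1 1 (s≤s z≤n) (s≤s z≤n) r₁ r₂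
  pigeonhole (inj₂ r₀) (inj₁ _)  (inj₂ r₂) = clash p∤a′ 0 2 (s≤s z≤n) ≤-refl r₀ r₂

middle-index : ∀ {a b k} → a ≤ k → b ≤ k → suc (a + suc b) ≡ 2 * suc k → a ≡ k
middle-index {a} {b} {k} a≤k b≤k total = ≤-antisym a≤k (+-cancelʳ-≤ k k a (begin
  k + k  ≡⟨ a+b≡k+k ⟨
  a + b  ≤⟨ +-monoʳ-≤ a b≤k ⟩
  a + k  ∎))
  where
  open ≤-Reasoning
  a+b≡k+k : a + b ≡ k + k
  a+b≡k+k = suc-injective (begin-equality
    suc (a + b)      ≡⟨ +-suc a b ⟨
    a + suc b        ≡⟨ suc-injective total ⟩
    k + suc (k + 0)  ≡⟨ cong (k +_) (cong suc (+-identityʳ k)) ⟩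
    k + suc k        ≡⟨ +-suc k k ⟩
    suc (k + k)      ∎)

other-half : ∀ {a b k} → a ≡ k → suc (a + suc b) ≡ 2 * suc k → b ≡ k
other-half {b = b} {k} refl total =
  suc-injective (trans (+-cancelˡ-≡ (suc k) (suc b) (suc k + 0) total) (+-identityʳ (suc k)))

align-pivot : ∀ {W X : Set} (ws : List W) (A : List X) t R → length ws ≡ length (A ++ t ∷ R)
  → ∃[ wsA ] ∃[ w ] ∃[ wsR ] (ws ≡ wsA ++ w ∷ wsR × length wsA ≡ length A × length wsR ≡ length R)
align-pivot []       []      t R ()
align-pivot []       (_ ∷ _) t R ()
align-pivot (w ∷ ws) []      t R eq = [] , w , ws , refl , refl , suc-injective eq
align-pivot (w ∷ ws) (a ∷ A) t R eq with align-pivot ws A t R (suc-injective eq)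
... | wsA , v , wsR , refl , lenA , lenR = w ∷ wsA , v , wsR , refl , cong suc lenA , lenR

map-≡-++-∷⁻ : ∀ {X Y : Set} (f : X → Y) xs {A t B} → map f xs ≡ A ++ t ∷ B
  → ∃[ A′ ] ∃[ t′ ] ∃[ B′ ] (xs ≡ A′ ++ t′ ∷ B′ × map f A′ ≡ A × f t′ ≡ t × map f B′ ≡ B)
map-≡-++-∷⁻ f []       {[]}    ()
map-≡-++-∷⁻ f []       {_ ∷ _} ()
map-≡-++-∷⁻ f (x ∷ xs) {[]}    eq with ∷-injective eq
... | fx≡t , refl = [] , x , xs , refl , refl , fx≡t , refl
map-≡-++-∷⁻ f (x ∷ xs) {_ ∷ A} eq with ∷-injective eq
... | refl , eq′ with map-≡-++-∷⁻ f xs eq′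
...   | A′ , t′ , B′ , refl , refl , ft′≡t , refl = x ∷ A′ , t′ , B′ , refl , refl , ft′≡t , refl

++-cancel-length : ∀ {X : Set} (A C : List X) {B D} → length A ≡ length C → A ++ B ≡ C ++ D → A ≡ C × B ≡ D
++-cancel-length []      []      _   eq = refl , eq
++-cancel-length (a ∷ A) (c ∷ C) len eq with ∷-injective eq
... | refl , eq′ with ++-cancel-length A C (suc-injective len) eq′
...   | refl , B≡D = refl , B≡D

wsum : List ℕ → List ℕ → ℕ
wsum ws xs = sum (zipWith _*_ ws xs)

UnitZeroSum : ℕ → List ℕ → Set
UnitZeroSum m xs = ∃[ ws ] (length ws ≡ length xs × All (λ w → Coprime w m) ws × m ∣ wsum ws xs)

wsum-++ : ∀ wsA A ws xs → length wsA ≡ length A → wsum (wsA ++ ws) (A ++ xs) ≡ wsum wsA A + wsum ws xs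
wsum-++ []        []      ws xs _  = refl
wsum-++ (w ∷ wsA) (a ∷ A) ws xs eq =
  trans (cong (w * a +_) (wsum-++ wsA A ws xs (suc-injective eq))) (sym (+-assoc (w * a) _ _))

wsum-*ʳ : ∀ p ws xs → wsum ws (map (p *_) xs) ≡ p * wsum ws xs
wsum-*ʳ p []       xs       = sym (*-zeroʳ p)
wsum-*ʳ p (w ∷ ws) []       = sym (*-zeroʳ p)
wsum-*ʳ p (w ∷ ws) (x ∷ xs) = trans (cong (w * (p * x) +_) (wsum-*ʳ p ws xs))
  (solve 4 (λ w p x s → w :* (p :* x) :+ p :* s := p :* (w :* x :+ s)) refl w p x (wsum ws xs))

wsum-∣ : ∀ {q} ws {xs} → All (q ∣_) xs → q ∣ wsum ws xs
wsum-∣ []       _          = _ ∣0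
wsum-∣ (w ∷ ws) []         = _ ∣0
wsum-∣ (w ∷ ws) (q∣x ∷ q∣xs) = ∣m∣n⇒∣m+n (∣n⇒∣m*n w q∣x) (wsum-∣ ws q∣xs)

RaisedBy : ℕ → ℕ → ℕ → Set
RaisedBy m w′ w = ∃[ e ] w′ ≡ w + m * e

RaisedBy-refl : ∀ m → Reflexive (RaisedBy m)
RaisedBy-refl m {w} = 0 , sym (trans (cong (w +_) (*-zeroʳ m)) (+-identityʳ w))

wsum-raise : ∀ m {ws′ ws} → Pointwise (RaisedBy m) ws′ ws → ∀ xs → ∃[ E ] wsum ws′ xs ≡ wsum ws xs + m * E
wsum-raise m []                          xs       = 0 , sym (*-zeroʳ m)
wsum-raise m (_ ∷ _)                     []       = 0 , sym (*-zeroʳ m)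
wsum-raise m {_ ∷ _} {w ∷ ws} ((e , refl) ∷ raised) (x ∷ xs) with wsum-raise m raised xs
... | E , eq = e * x + E , trans (cong ((w + m * e) * x +_) eq)
  (solve 6 (λ w m e x s E → (w :+ m :* e) :* x :+ (s :+ m :* E) := w :* x :+ s :+ m :* (e :* x :+ E))
         refl w m e x (wsum ws xs) E)

wsum-raise-∣ : ∀ m {ws′ ws} → Pointwise (RaisedBy m) ws′ ws → ∀ xs → m ∣ wsum ws xs → m ∣ wsum ws′ xs
wsum-raise-∣ m raised xs m∣ with wsum-raise m raised xs
... | E , eq = subst (m ∣_) (sym eq) (∣m∣n⇒∣m+n m∣ (m∣m*n E))

wsum-raise-∣⁻ : ∀ m {ws′ ws} → Pointwise (RaisedBy m) ws′ ws → ∀ xs → m ∣ wsum ws′ xs → m ∣ wsum ws xs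
wsum-raise-∣⁻ m raised xs m∣ with wsum-raise m raised xs
... | E , eq = ∣m+n∣m⇒∣n (subst (m ∣_) (trans eq (+-comm _ (m * E))) m∣) (m∣m*n E)

units-map : ∀ {n n′ ws} → (∀ {w} → Coprime w n → Coprime w n′)
          → All (λ w → Coprime w n) ws → All (λ w → Coprime w n′) ws
units-map f []             = []
units-map f (w⊥n ∷ ws⊥n) = f w⊥n ∷ units-map f ws⊥n

units-∣ : ∀ {m n ws} → m ∣ n → All (λ w → Coprime w n) ws → All (λ w → Coprime w m) ws
units-∣ m∣n = units-map (λ w⊥n → coprime-∣ʳ w⊥n m∣n)

lift-units : ∀ {p m ws} → Prime p → All (λ w → Coprime w m) ws
           → ∃[ ws′ ] (Pointwise (RaisedBy m) ws′ ws × All (λ w → Coprime w (p * m)) ws′)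
lift-units pr [] = [] , [] , []
lift-units {m = m} {w ∷ ws} pr (w⊥m ∷ ws⊥m) with ∃-coprime-lift pr w⊥m | lift-units pr ws⊥m
... | e , w′⊥pm | ws′ , raised , ws′⊥pm = w + m * e ∷ ws′ , (e , refl) ∷ raised , w′⊥pm ∷ ws′⊥pm

unitZeroSum-*ˡ : ∀ {p m xs} → Prime p → UnitZeroSum m xs → UnitZeroSum (p * m) (map (p *_) xs)
unitZeroSum-*ˡ {p} {m} {xs} pr (ws , len , ws⊥m , m∣) with lift-units pr ws⊥m
... | ws′ , raised , ws′⊥pm =
  ws′ , trans (Pointwise-length raised) (trans len (sym (length-map _ xs))) , ws′⊥pm ,
  subst (p * m ∣_) (sym (wsum-*ʳ p ws′ xs)) (*-monoʳ-∣ p (wsum-raise-∣ m raised xs m∣))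

unitZeroSum-*ˡ⁻ : ∀ {p m xs} → .{{NonZero p}} → UnitZeroSum (p * m) (map (p *_) xs) → UnitZeroSum m xs
unitZeroSum-*ˡ⁻ {p} {m} {xs} (ws , len , ws⊥pm , pm∣) =
  ws , trans len (length-map _ xs) , units-∣ (n∣m*n p) ws⊥pm ,
  *-cancelˡ-∣ p (subst (p * m ∣_) (wsum-*ʳ p ws xs) pm∣)

raise-at : ∀ m xs {y} s ys → Pointwise (RaisedBy m) (xs ++ (y + m * s) ∷ ys) (xs ++ y ∷ ys)
raise-at m xs s ys = Pointwise.++⁺ (Pointwise.refl (RaisedBy-refl m)) ((s , refl) ∷ Pointwise.refl (RaisedBy-refl m))

∃-pivot-adjustment : ∀ {m p t t₂} → Prime p → 2 < p → ¬ p ∣ m → ¬ p ∣ t → ¬ p ∣ t₂ → ∀ a b c w₁ w₂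
  → ∃[ s₁ ] ∃[ s₂ ] (¬ p ∣ w₁ + m * s₁ × ¬ p ∣ w₂ + m * s₂
                     × p ∣ a + ((w₁ + m * s₁) * t + (b + ((w₂ + m * s₂) * t₂ + c))))
∃-pivot-adjustment {m} {p} {t} {t₂} pr p>2 p∤m p∤t p∤t₂ a b c w₁ w₂
  with ∃-common-nonroot pr p>2 p∤m (prime∤* pr p∤m p∤t) w₁ (a + w₁ * t + (b + c))
... | s₁ , p∤w₁′ , p∤Z with ∃-linear-root pr (prime∤* pr p∤m p∤t₂) (a + w₁ * t + (b + c) + m * t * s₁ + w₂ * t₂)
... | s₂ , p∣total = s₁ , s₂ , p∤w₁′ , p∤w₂′ , subst (p ∣_) (sym regroup) p∣total
  where
  Z = a + w₁ * t + (b + c) + m * t * s₁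
  regroup : a + ((w₁ + m * s₁) * t + (b + ((w₂ + m * s₂) * t₂ + c))) ≡ Z + w₂ * t₂ + m * t₂ * s₂
  regroup = solve 10 (λ a w₁ m s₁ t b w₂ s₂ t₂ c →
    a :+ ((w₁ :+ m :* s₁) :* t :+ (b :+ ((w₂ :+ m :* s₂) :* t₂ :+ c)))
    := a :+ w₁ :* t :+ (b :+ c) :+ m :* t :* s₁ :+ w₂ :* t₂ :+ m :* t₂ :* s₂) refl a w₁ m s₁ t b w₂ s₂ t₂ c
  -- The second weight is forced by the congruence; it avoids p because Z does.
  p∤w₂′ : ¬ p ∣ w₂ + m * s₂
  p∤w₂′ p∣w₂′ = p∤Z (∣m+n∣m⇒∣n (subst (p ∣_) isolate p∣total) (∣m⇒∣m*n t₂ p∣w₂′))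
    where
    isolate : Z + w₂ * t₂ + m * t₂ * s₂ ≡ (w₂ + m * s₂) * t₂ + Z
    isolate = solve 5 (λ Z w₂ t₂ m s₂ → Z :+ w₂ :* t₂ :+ m :* t₂ :* s₂ := (w₂ :+ m :* s₂) :* t₂ :+ Z)
                      refl Z w₂ t₂ m s₂

unitZeroSum-lift-p∣m : ∀ {m p t} {A R : List ℕ} → Prime p → p ∣ m → ¬ p ∣ t
                     → UnitZeroSum m (A ++ t ∷ R) → UnitZeroSum (p * m) (A ++ t ∷ R)
unitZeroSum-lift-p∣m {m} {p} {t} {A} {R} pr p∣m p∤t (ws , len , ws⊥m , m∣)
  with align-pivot ws A t R len
... | wsA , w , wsR , refl , lenA , _ with All.++⁻ wsA ws⊥m | ∃-linear-root pr p∤t (quotient m∣)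
... | wsA⊥m , w⊥m ∷ wsR⊥m | s , p∣K+ts =
  wsA ++ (w + m * s) ∷ wsR , trans (Pointwise-length (raise-at m wsA s wsR)) len ,
  units-map (λ w⊥m → coprime-*ʳ (coprime-∣ʳ w⊥m p∣m) w⊥m) (All.++⁺ wsA⊥m (coprime-+-*ˡ s w⊥m ∷ wsR⊥m)) ,
  subst (p * m ∣_) (sym raised) (subst (_∣ m * (K + t * s)) (*-comm m p) (*-monoʳ-∣ m p∣K+ts))
  where
  K = quotient m∣
  a = wsum wsA A
  b = wsum wsR R
  raised : wsum (wsA ++ (w + m * s) ∷ wsR) (A ++ t ∷ R) ≡ m * (K + t * s)
  raised = begin
    wsum (wsA ++ (w + m * s) ∷ wsR) (A ++ t ∷ R)
      ≡⟨ wsum-++ wsA A _ (t ∷ R) lenA ⟩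
    a + ((w + m * s) * t + b)
      ≡⟨ solve 6 (λ a w m s t b → a :+ ((w :+ m :* s) :* t :+ b) := (a :+ (w :* t :+ b)) :+ m :* (t :* s))
                 refl a w m s t b ⟩
    (a + (w * t + b)) + m * (t * s)
      ≡⟨ cong (_+ m * (t * s)) (trans (sym (wsum-++ wsA A (w ∷ wsR) (t ∷ R) lenA)) (m∣n⇒n≡quotient*m m∣)) ⟩
    K * m + m * (t * s)
      ≡⟨ solve 4 (λ K m t s → K :* m :+ m :* (t :* s) := m :* (K :+ t :* s)) refl K m t s ⟩
    m * (K + t * s)
      ∎
    where open ≡-Reasoning

unitZeroSum-adjust-p∤m : ∀ {m p t t₂} {A B C : List ℕ} → Prime p → 2 < p → ¬ p ∣ m → ¬ p ∣ t → ¬ p ∣ t₂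
  → ∀ wsA w₁ wsB w₂ wsC → length wsA ≡ length A → length wsB ≡ length B
  → length (wsA ++ w₁ ∷ wsB ++ w₂ ∷ wsC) ≡ length (A ++ t ∷ B ++ t₂ ∷ C)
  → All (λ w → Coprime w (p * m)) (wsA ++ w₁ ∷ wsB ++ w₂ ∷ wsC)
  → m ∣ wsum (wsA ++ w₁ ∷ wsB ++ w₂ ∷ wsC) (A ++ t ∷ B ++ t₂ ∷ C)
  → UnitZeroSum (p * m) (A ++ t ∷ B ++ t₂ ∷ C)
unitZeroSum-adjust-p∤m {m} {p} {t} {t₂} {A} {B} {C} pr p>2 p∤m p∤t p∤t₂ wsA w₁ wsB w₂ wsC lenA lenB len units m∣ =
  adjust (∃-pivot-adjustment pr p>2 p∤m p∤t p∤t₂ (wsum wsA A) (wsum wsB B) (wsum wsC C) w₁ w₂) (All.++⁻ wsA units)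
  where
  T = A ++ t ∷ B ++ t₂ ∷ C
  expand : ∀ x y → wsum (wsA ++ x ∷ wsB ++ y ∷ wsC) T ≡ wsum wsA A + (x * t + (wsum wsB B + (y * t₂ + wsum wsC C)))
  expand x y = trans (wsum-++ wsA A (x ∷ wsB ++ y ∷ wsC) (t ∷ B ++ t₂ ∷ C) lenA)
                     (cong (λ z → wsum wsA A + (x * t + z)) (wsum-++ wsB B (y ∷ wsC) (t₂ ∷ C) lenB))
  unit : ∀ {w} s → Coprime w (p * m) → ¬ p ∣ w + m * s → Coprime (w + m * s) (p * m)
  unit s w⊥pm p∤w′ = coprime-*-prime pr p∤w′ (coprime-+-*ˡ s (coprime-∣ʳ w⊥pm (n∣m*n p)))
  adjust : ∃[ s₁ ] ∃[ s₂ ] (¬ p ∣ w₁ + m * s₁ × ¬ p ∣ w₂ + m * s₂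
             × p ∣ wsum wsA A + ((w₁ + m * s₁) * t + (wsum wsB B + ((w₂ + m * s₂) * t₂ + wsum wsC C))))
         → All (λ w → Coprime w (p * m)) wsA × All (λ w → Coprime w (p * m)) (w₁ ∷ wsB ++ w₂ ∷ wsC)
         → UnitZeroSum (p * m) T
  adjust (s₁ , s₂ , p∤w₁′ , p∤w₂′ , p∣S′) (wsA⊥ , w₁⊥ ∷ wsR⊥) with All.++⁻ wsB wsR⊥
  ... | wsB⊥ , w₂⊥ ∷ wsC⊥ =
    ws′ , trans (Pointwise-length raised) len ,
    All.++⁺ wsA⊥ (unit s₁ w₁⊥ p∤w₁′ ∷ All.++⁺ wsB⊥ (unit s₂ w₂⊥ p∤w₂′ ∷ wsC⊥)) ,
    coprime-*-∣ (coprime-sym (prime∤⇒coprime pr p∤m))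
                (subst (p ∣_) (sym (expand _ _)) p∣S′) (wsum-raise-∣ m raised T m∣)
    where
    ws′ = wsA ++ (w₁ + m * s₁) ∷ wsB ++ (w₂ + m * s₂) ∷ wsC
    raised : Pointwise (RaisedBy m) ws′ (wsA ++ w₁ ∷ wsB ++ w₂ ∷ wsC)
    raised = Pointwise.++⁺ (Pointwise.refl (RaisedBy-refl m)) ((s₁ , refl) ∷ raise-at m wsB s₂ wsC)

unitZeroSum-lift-p∤m : ∀ {m p t t₂} {A B C : List ℕ} → Prime p → 2 < p → ¬ p ∣ m → ¬ p ∣ t → ¬ p ∣ t₂
  → UnitZeroSum m (A ++ t ∷ B ++ t₂ ∷ C) → UnitZeroSum (p * m) (A ++ t ∷ B ++ t₂ ∷ C)
unitZeroSum-lift-p∤m {m} {p} {t} {t₂} {A} {B} {C} pr p>2 p∤m p∤t p∤t₂ (ws , len , ws⊥m , m∣)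
  with lift-units pr ws⊥m
... | ws′ , raised , ws′⊥pm with align-pivot ws′ A t (B ++ t₂ ∷ C) (trans (Pointwise-length raised) len)
... | wsA , w₁ , wsR , refl , lenA , lenR with align-pivot wsR B t₂ C lenR
... | wsB , w₂ , wsC , refl , lenB , _ =
  unitZeroSum-adjust-p∤m pr p>2 p∤m p∤t p∤t₂ wsA w₁ wsB w₂ wsC lenA lenB (trans (Pointwise-length raised) len) ws′⊥pm
    (wsum-raise-∣ m raised (A ++ t ∷ B ++ t₂ ∷ C) m∣)

-- The separating modulus q need not be prime: multiplying every term by p turns q into p * q.
record Separation (n : ℕ) (T : List ℕ) : Set where
  field
    q : ℕ
    q∣n : q ∣ n
    before : List ℕ
    pivot : ℕ
    after : List ℕ
    split : T ≡ before ++ pivot ∷ after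
    q∤pivot : ¬ q ∣ pivot
    q∣before : All (q ∣_) before
    q∣after : All (q ∣_) after

separation-∣ : ∀ {m n T} → m ∣ n → Separation m T → Separation n T
separation-∣ m∣n record { q∣n = q∣m ; split = split ; q∤pivot = q∤t ; q∣before = q∣A ; q∣after = q∣B } =
  record { q∣n = ∣-trans q∣m m∣n ; split = split ; q∤pivot = q∤t ; q∣before = q∣A ; q∣after = q∣B }

separation-*ˡ : ∀ {m p T} → .{{NonZero p}} → Separation m T → Separation (p * m) (map (p *_) T)
separation-*ˡ {p = p} record { q = q ; q∣n = q∣m ; before = A ; pivot = t ; after = B ; split = refl
                             ; q∤pivot = q∤t ; q∣before = q∣A ; q∣after = q∣B } = record
  { q = p * q ; q∣n = *-monoʳ-∣ p q∣m
  ; before = map (p *_) A ; pivot = p * t ; after = map (p *_) B ; split = map-++ (p *_) A (t ∷ B)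
  ; q∤pivot = q∤t ∘ *-cancelˡ-∣ p
  ; q∣before = All.map⁺ (All.map (*-monoʳ-∣ p) q∣A) ; q∣after = All.map⁺ (All.map (*-monoʳ-∣ p) q∣B) }

all-∣⇒map-* : ∀ {p} T → All (p ∣_) T → ∃[ T′ ] T ≡ map (p *_) T′
all-∣⇒map-* []      []                      = [] , refl
all-∣⇒map-* {p} (_ ∷ T) (divides q refl ∷ p∣T) with all-∣⇒map-* T p∣T
... | T′ , refl = q ∷ T′ , cong (_∷ map (p *_) T′) (*-comm q p)

unitZeroSum⊎separation-*ˡ : ∀ {m p} → Prime p → 2 < p → (∀ T → UnitZeroSum m T ⊎ Separation m T)
                         → ∀ T → UnitZeroSum (p * m) T ⊎ Separation (p * m) T
unitZeroSum⊎separation-*ˡ {m} {p} pr p>2 ih T with first (toSum ∘ (p ∣?_)) T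
... | inj₂ p∣T with all-∣⇒map-* T p∣T
...   | T′ , refl with ih T′
...     | inj₁ zs  = inj₁ (unitZeroSum-*ˡ pr zs)
...     | inj₂ sep = inj₂ (separation-*ˡ {{prime⇒nonZero pr}} sep)
unitZeroSum⊎separation-*ˡ {m} {p} pr p>2 ih T | inj₁ firstA with toView firstA
... | FirstView._++_∷_ {A} {t} p∣A p∤t R with first (toSum ∘ (p ∣?_)) R
...   | inj₂ p∣R = inj₂ (record { q = p ; q∣n = m∣m*n m ; before = A ; pivot = t ; after = R ; split = refl
                                ; q∤pivot = p∤t ; q∣before = p∣A ; q∣after = p∣R })
...   | inj₁ firstB with toView firstB
...     | FirstView._++_∷_ {B} {t₂} _ p∤t₂ C with ih (A ++ t ∷ B ++ t₂ ∷ C) | p ∣? m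
...       | inj₂ sep | _       = inj₂ (separation-∣ (n∣m*n p) sep)
...       | inj₁ zs  | yes p∣m = inj₁ (unitZeroSum-lift-p∣m pr p∣m p∤t zs)
...       | inj₁ zs  | no p∤m  = inj₁ (unitZeroSum-lift-p∤m pr p>2 p∤m p∤t p∤t₂ zs)

∃-prime-divisor : ∀ n → n ≢ 1 → ∃[ p ] (Prime p × p ∣ n)
∃-prime-divisor zero      _   = 2 , prime[2] , (2 ∣0)
∃-prime-divisor n@(suc _) n≢1 with factorise n
... | record { factors = [] ; isFactorisation = n≡1 } = ⊥-elim (n≢1 n≡1)
... | record { factors = p ∷ ps ; isFactorisation = n≡p*Πps ; factorsPrime = pr ∷ _ } =
  p , pr , divides (product ps) (trans n≡p*Πps (*-comm p _))

unitZeroSum⊎separation : ∀ n → ¬ 2 ∣ n → ∀ T → UnitZeroSum n T ⊎ Separation n T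
unitZeroSum⊎separation = <-rec _ induct
  where
  induct : ∀ n → (∀ {m} → m < n → ¬ 2 ∣ m → ∀ T → UnitZeroSum m T ⊎ Separation m T)
         → ¬ 2 ∣ n → ∀ T → UnitZeroSum n T ⊎ Separation n T
  induct n ih 2∤n T with n ≟ 1
  ... | yes refl = inj₁ (replicate (length T) 1 , length-replicate _ , All.replicate⁺ _ (1-coprimeTo 1) , 1∣ _)
  ... | no n≢1 with ∃-prime-divisor n n≢1
  ...   | p , pr , divides m refl =
    subst (λ n → UnitZeroSum n T ⊎ Separation n T) (*-comm p m)
          (unitZeroSum⊎separation-*ˡ pr p>2 (ih (m<m*n m p (prime⇒≥2 pr)) 2∤m) T)
    where
    2∤m : ¬ 2 ∣ m
    2∤m 2∣m = 2∤n (∣-trans 2∣m (m∣m*n p))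
    instance
      m≢0 : NonZero m
      m≢0 = m*n≢0⇒m≢0 m {{≢-nonZero (λ mp≡0 → 2∤n (subst (2 ∣_) (sym mp≡0) (2 ∣0)))}}
    p>2 : 2 < p
    p>2 = ≤∧≢⇒< (prime⇒≥2 pr) (λ 2≡p → 2∤n (∣-trans (∣-reflexive 2≡p) (n∣m*n m)))

weightedSum≡wsum : ∀ {m} (ws xs : List (Fin m)) → weightedSum ws xs ≡ wsum (map toℕ ws) (map toℕ xs)
weightedSum≡wsum ws xs = cong sum (sym (zipWith-map _*_ toℕ toℕ ws xs))

weightedZeroSum⇒unitZeroSum : ∀ {m} {xs : List (Fin m)} → WeightedZeroSum (U m) xs → UnitZeroSum m (map toℕ xs)
weightedZeroSum⇒unitZeroSum {m} {xs} (_ , ws , len , ws∈U , m∣) =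
  map toℕ ws , trans (length-map toℕ ws) (trans len (sym (length-map toℕ xs))) , All.map⁺ ws∈U ,
  subst (m ∣_) (weightedSum≡wsum ws xs) m∣

unitZeroSum⇒weightedZeroSum : ∀ {m} .{{_ : NonZero m}} {xs : List (Fin m)} → xs ≢ []
                            → UnitZeroSum m (map toℕ xs) → WeightedZeroSum (U m) xs
unitZeroSum⇒weightedZeroSum {m} {xs} xs≢[] (ws , len , ws⊥m , m∣) =
  xs≢[] , map (_mod m) ws , trans (length-map _ ws) (trans len (length-map toℕ xs)) , All.map⁺ (reduce-units ws⊥m) ,
  subst (m ∣_) (sym (weightedSum≡wsum (map (_mod m) ws) xs)) (wsum-raise-∣⁻ m (reduce ws) (map toℕ xs) m∣)
  where
  toℕ-mod : ∀ w → toℕ (w mod m) ≡ w % m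
  toℕ-mod w = toℕ-fromℕ< (m%n<n w m)
  reduce : ∀ ws → Pointwise (RaisedBy m) ws (map toℕ (map (_mod m) ws))
  reduce []       = []
  reduce (w ∷ ws) = (w / m , trans (m≡m%n+[m/n]*n w m) (cong₂ _+_ (sym (toℕ-mod w)) (*-comm (w / m) m))) ∷ reduce ws
  reduce-units : ∀ {ws} → All (λ w → Coprime w m) ws → All (λ w → Coprime (toℕ (w mod m)) m) ws
  reduce-units []                       = []
  reduce-units {w ∷ _} (w⊥m ∷ ws⊥m) = subst (λ r → Coprime r m) (sym (toℕ-mod w)) (coprime-% w⊥m) ∷ reduce-units ws⊥m

module _ {X : Set} where

  Block-++⁺ʳ : ∀ {ys xs : List X} zs → Block ys xs → Block ys (xs ++ zs)
  Block-++⁺ʳ {ys} zs (ys≢[] , pre , suf , refl) =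
    ys≢[] , pre , suf ++ zs , trans (++-assoc pre (ys ++ suf) zs) (cong (pre ++_) (++-assoc ys suf zs))

  Block-++⁺ˡ : ∀ {ys xs : List X} zs → Block ys xs → Block ys (zs ++ xs)
  Block-++⁺ˡ {ys} zs (ys≢[] , pre , suf , refl) = ys≢[] , zs ++ pre , suf , sym (++-assoc zs pre (ys ++ suf))

  Block-refl : ∀ {xs : List X} → xs ≢ [] → Block xs xs
  Block-refl {xs} xs≢[] = xs≢[] , [] , [] , sym (++-identityʳ xs)

  ¬Block-[] : ∀ {ys : List X} → ¬ Block ys []
  ¬Block-[] {ys} (ys≢[] , pre , suf , []≡) = ys≢[] (++-conicalˡ ys suf (++-conicalʳ pre _ (sym []≡)))

  ++-∷-≡-++ : ∀ (L : List X) t R P Q → L ++ t ∷ R ≡ P ++ Q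
            → (∃[ Z ] (P ≡ L ++ t ∷ Z × R ≡ Z ++ Q)) ⊎ (∃[ Z ] (L ≡ P ++ Z × Q ≡ Z ++ t ∷ R))
  ++-∷-≡-++ L       t R []      Q eq = inj₂ (L , refl , sym eq)
  ++-∷-≡-++ []      t R (p ∷ P) Q eq with ∷-injective eq
  ... | refl , R≡P++Q = inj₁ (P , refl , R≡P++Q)
  ++-∷-≡-++ (l ∷ L) t R (p ∷ P) Q eq with ∷-injective eq
  ... | refl , eq′ with ++-∷-≡-++ L t R P Q eq′
  ...   | inj₁ (Z , refl , R≡) = inj₁ (Z , refl , R≡)
  ...   | inj₂ (Z , refl , Q≡) = inj₂ (Z , refl , Q≡)

  Straddles : List X → X → List X → List X → Set
  Straddles L t R ys = ∃[ L₁ ] ∃[ Y₁ ] ∃[ Y₂ ] ∃[ R₂ ] (L ≡ L₁ ++ Y₁ × ys ≡ Y₁ ++ t ∷ Y₂ × R ≡ Y₂ ++ R₂)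

  Block-++-∷⁻ : ∀ {ys} L t R → Block ys (L ++ t ∷ R) → Block ys L ⊎ Block ys R ⊎ Straddles L t R ys
  Block-++-∷⁻ {ys} L t R (ys≢[] , pre , suf , eq) with ++-∷-≡-++ L t R pre (ys ++ suf) eq
  ... | inj₁ (Z , _ , R≡) = inj₂ (inj₁ (ys≢[] , Z , suf , R≡))
  ... | inj₂ (Z , refl , ys++suf≡) with ++-∷-≡-++ Z t R ys suf (sym ys++suf≡)
  ...   | inj₁ (Y₂ , ys≡ , R≡) = inj₂ (inj₂ (pre , Z , Y₂ , suf , refl , ys≡ , R≡))
  ...   | inj₂ (W , refl , _)  = inj₁ (ys≢[] , pre , W , refl)

module _ {X Y : Set} {_∼_ : X → Y → Set} where

  Pointwise-++⁻ : ∀ (A : List X) {B zs} → Pointwise _∼_ (A ++ B) zs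
                → ∃[ A′ ] ∃[ B′ ] (zs ≡ A′ ++ B′ × Pointwise _∼_ A A′ × Pointwise _∼_ B B′)
  Pointwise-++⁻ []      B∼        = [] , _ , refl , [] , B∼
  Pointwise-++⁻ (a ∷ A) (a∼ ∷ A∼) with Pointwise-++⁻ A A∼
  ... | A′ , B′ , refl , A∼A′ , B∼B′ = _ ∷ A′ , B′ , refl , a∼ ∷ A∼A′ , B∼B′

  Pointwise-≢[] : ∀ {xs zs} → Pointwise _∼_ xs zs → xs ≢ [] → zs ≢ []
  Pointwise-≢[] [] xs≢[] refl = xs≢[] refl

  Block-Pointwise : ∀ {xs zs ys} → Pointwise _∼_ xs zs → Block ys xs → ∃[ ys′ ] (Pointwise _∼_ ys ys′ × Block ys′ zs)
  Block-Pointwise {ys = ys} xs∼zs (ys≢[] , pre , suf , refl) with Pointwise-++⁻ pre xs∼zs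
  ... | pre′ , _ , refl , _ , rest with Pointwise-++⁻ ys rest
  ...   | ys′ , suf′ , refl , ys∼ys′ , _ = ys′ , ys∼ys′ , Pointwise-≢[] ys∼ys′ ys≢[] , pre′ , suf′ , refl

ZeroSumFree : (m : ℕ) → List (Fin m) → Set
ZeroSumFree m xs = ¬ HasZeroSumBlock (U m) xs

module _ {m : ℕ} where

  zeroSumFree-[] : ZeroSumFree m []
  zeroSumFree-[] (_ , block , _) = ¬Block-[] block

  zeroSumFree-++⁻ˡ : ∀ xs {ys : List (Fin m)} → ZeroSumFree m (xs ++ ys) → ZeroSumFree m xs
  zeroSumFree-++⁻ˡ xs {ys} free (zs , block , zero-sum) = free (zs , Block-++⁺ʳ ys block , zero-sum)

  zeroSumFree-++⁻ʳ : ∀ xs {ys : List (Fin m)} → ZeroSumFree m (xs ++ ys) → ZeroSumFree m ys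
  zeroSumFree-++⁻ʳ xs free (zs , block , zero-sum) = free (zs , Block-++⁺ˡ xs block , zero-sum)

  zeroSumFree⇒¬AllHaveBlock : ∀ {c} (xs : List (Fin m)) → ZeroSumFree m xs → c ≤ length xs → ¬ AllHaveBlock m (U m) c
  zeroSumFree⇒¬AllHaveBlock {c} xs free c≤∣xs∣ allHave
    with allHave (take c xs) (trans (length-take c xs) (m≤n⇒m⊓n≡m c≤∣xs∣))
  ... | zs , block , zero-sum =
    free (zs , subst (Block zs) (take++drop≡id c xs) (Block-++⁺ʳ (drop c xs) block) , zero-sum)

  -- Modulo q the weighted sum reduces to w * t with w a unit, which q does not divide.
  ¬unitZeroSum-separated : ∀ {q} → q ∣ m → ∀ Y₁ t Y₂ → All (q ∣_) Y₁ → All (q ∣_) Y₂ → ¬ q ∣ t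
                         → ¬ UnitZeroSum m (Y₁ ++ t ∷ Y₂)
  ¬unitZeroSum-separated {q} q∣m Y₁ t Y₂ q∣Y₁ q∣Y₂ q∤t (ws , len , ws⊥m , m∣) with align-pivot ws Y₁ t Y₂ len
  ... | ws₁ , w , ws₂ , refl , len₁ , _ with All.++⁻ ws₁ ws⊥m
  ...   | _ , w⊥m ∷ _ = q∤t (coprime-divisor (coprime-sym (coprime-∣ʳ w⊥m q∣m)) q∣wt)
    where
    q∣sum : q ∣ wsum ws₁ Y₁ + (w * t + wsum ws₂ Y₂)
    q∣sum = subst (q ∣_) (wsum-++ ws₁ Y₁ (w ∷ ws₂) (t ∷ Y₂) len₁) (∣-trans q∣m m∣)
    q∣wt : q ∣ w * t
    q∣wt = ∣m+n∣m⇒∣n (subst (q ∣_) (+-comm (w * t) _) (∣m+n∣m⇒∣n q∣sum (wsum-∣ ws₁ q∣Y₁))) (wsum-∣ ws₂ q∣Y₂)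

  zeroSumFree-separated : ∀ {q} → q ∣ m → (L : List (Fin m)) (t : Fin m) (R : List (Fin m))
    → ZeroSumFree m L → ZeroSumFree m R → All (λ y → q ∣ toℕ y) L → All (λ y → q ∣ toℕ y) R → ¬ q ∣ toℕ t
    → ZeroSumFree m (L ++ t ∷ R)
  zeroSumFree-separated q∣m L t R freeL freeR q∣L q∣R q∤t (ys , block , zero-sum) with Block-++-∷⁻ L t R block
  ... | inj₁ blockL        = freeL (ys , blockL , zero-sum)
  ... | inj₂ (inj₁ blockR) = freeR (ys , blockR , zero-sum)
  ... | inj₂ (inj₂ (L₁ , Y₁ , Y₂ , R₂ , refl , refl , refl)) =
    ¬unitZeroSum-separated q∣m (map toℕ Y₁) (toℕ t) (map toℕ Y₂)
      (All.map⁺ (All.++⁻ʳ L₁ q∣L)) (All.map⁺ (All.++⁻ˡ Y₂ q∣R)) q∤t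
      (subst (UnitZeroSum m) (map-++ toℕ Y₁ (t ∷ Y₂)) (weightedZeroSum⇒unitZeroSum zero-sum))

  private
    zeroSumFrom? : ∀ acc (xs : List (Fin m))
      → Dec (∃[ ws ] (length ws ≡ length xs × All (U m) ws × m ∣ acc + weightedSum ws xs))
    zeroSumFrom? acc [] with m ∣? acc + 0
    ... | yes m∣ = yes ([] , refl , [] , m∣)
    ... | no m∤  = no λ { ([] , _ , _ , m∣) → m∤ m∣ }
    zeroSumFrom? acc (x ∷ xs) with any? (λ w → coprime? (toℕ w) m ×-dec zeroSumFrom? (acc + toℕ w * toℕ x) xs)
    ... | yes (w , w∈U , ws , len , ws∈U , m∣) =
      yes (w ∷ ws , cong suc len , w∈U ∷ ws∈U , subst (m ∣_) (+-assoc acc _ _) m∣)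
    ... | no none = no λ { (w ∷ ws , len , w∈U ∷ ws∈U , m∣) →
      none (w , w∈U , ws , suc-injective len , ws∈U , subst (m ∣_) (sym (+-assoc acc _ _)) m∣) }

  weightedZeroSum? : ∀ (xs : List (Fin m)) → Dec (WeightedZeroSum (U m) xs)
  weightedZeroSum? []       = no λ { (ne , _) → ne refl }
  weightedZeroSum? (x ∷ xs) with zeroSumFrom? 0 (x ∷ xs)
  ... | yes (ws , zs) = yes ((λ ()) , ws , zs)
  ... | no none       = no λ { (_ , ws , zs) → none (ws , zs) }

module _ {X : Set} where

  private
    prefix? : (P : List X → Set) → (∀ ys → Dec (P ys)) → ∀ xs
            → Dec (∃[ ys ] (ys ≢ [] × (∃[ suf ] xs ≡ ys ++ suf) × P ys))
    prefix? P P? [] = no λ { ([] , ne , _) → ne refl ; (_ ∷ _ , _ , (_ , ()) , _) }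
    prefix? P P? (x ∷ xs) with P? (x ∷ []) | prefix? (P ∘ (x ∷_)) (P? ∘ (x ∷_)) xs
    ... | yes p | _ = yes (x ∷ [] , (λ ()) , (xs , refl) , p)
    ... | no _  | yes (ys , _ , (suf , refl) , p) = yes (x ∷ ys , (λ ()) , (suf , refl) , p)
    ... | no ¬p | no none = no λ
      { ([] , ne , _) → ne refl
      ; (_ ∷ [] , _ , (_ , refl) , p) → ¬p p
      ; (_ ∷ ys@(_ ∷ _) , _ , (suf , refl) , p) → none (ys , (λ ()) , (suf , refl) , p) }

  block? : (P : List X → Set) → (∀ ys → Dec (P ys)) → ∀ xs → Dec (∃[ ys ] (Block ys xs × P ys))
  block? P P? [] = no λ { (_ , block , _) → ¬Block-[] block }
  block? P P? (x ∷ xs) with prefix? P P? (x ∷ xs) | block? P P? xs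
  ... | yes (ys , ne , (suf , eq) , p) | _ = yes (ys , (ne , [] , suf , eq) , p)
  ... | no _ | yes (ys , (ne , pre , suf , refl) , p) = yes (ys , (ne , x ∷ pre , suf , refl) , p)
  ... | no noPrefix | no noBlock = no λ
    { (ys , (ne , [] , suf , eq) , p) → noPrefix (ys , ne , (suf , eq) , p)
    ; (ys , (ne , _ ∷ pre , suf , eq) , p) → noBlock (ys , (ne , pre , suf , ∷-injectiveʳ eq) , p) }

hasZeroSumBlock? : ∀ {m} (xs : List (Fin m)) → Dec (HasZeroSumBlock (U m) xs)
hasZeroSumBlock? {m} = block? (WeightedZeroSum (U m)) weightedZeroSum?

extremal⇒allHaveBlock : ∀ {m} (xs : List (Fin m)) → Extremal m (U m) xs → AllHaveBlock m (U m) (suc (length xs))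
extremal⇒allHaveBlock xs (c , ((_ , allHave , _) , ∣xs∣+1≡c) , _) = subst (AllHaveBlock _ _) (sym ∣xs∣+1≡c) allHave

zeroSumFree⇒extremal : ∀ {m} (xs : List (Fin m)) → AllHaveBlock m (U m) (suc (length xs)) → ZeroSumFree m xs
                     → Extremal m (U m) xs
zeroSumFree⇒extremal xs allHave free = suc (length xs) , ((s≤s z≤n , allHave , minimal) , refl) , free
  where
  minimal : ∀ j → 1 ≤ j → j < suc (length xs) → ¬ AllHaveBlock _ _ j
  minimal j _ (s≤s j≤∣xs∣) = zeroSumFree⇒¬AllHaveBlock xs free j≤∣xs∣

ScaledBy : ∀ {n n′} → ℕ → Fin n → Fin n′ → Set
ScaledBy p y y′ = toℕ y ≡ p * toℕ y′

prime∤fromℕ<-1 : ∀ {n p} → Prime p → (1<n : 1 < n) → ¬ p ∣ toℕ (fromℕ< 1<n)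
prime∤fromℕ<-1 {p = p} pr 1<n = prime⇒∤1 pr ∘ subst (p ∣_) (toℕ-fromℕ< 1<n)

module _ {n p n′ : ℕ} (pr : Prime p) (n≡pn′ : n ≡ p * n′) (1<n : 1 < n) where

  private
    variable
      xs ys : List (Fin n)
      xs′ ys′ : List (Fin n′)

  private instance
    n≢0 : NonZero n
    n≢0 = >-nonZero (<⇒≤ 1<n)
    p≢0 : NonZero p
    p≢0 = prime⇒nonZero pr
    n′≢0 : NonZero n′
    n′≢0 = m*n≢0⇒n≢0 p {{subst NonZero n≡pn′ n≢0}}

  map-toℕ-scaled : Pointwise (ScaledBy p) xs xs′ → map toℕ xs ≡ map (p *_) (map toℕ xs′)
  map-toℕ-scaled []              = refl
  map-toℕ-scaled (y≡py′ ∷ scaled) = cong₂ _∷_ y≡py′ (map-toℕ-scaled scaled)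

  weightedZeroSum-scale : Pointwise (ScaledBy p) ys ys′ → WeightedZeroSum (U n′) ys′ → WeightedZeroSum (U n) ys
  weightedZeroSum-scale scaled zs′@(ys′≢[] , _) =
    unitZeroSum⇒weightedZeroSum (Pointwise-≢[] (Pointwise.symmetric sym scaled) ys′≢[])
      (subst₂ UnitZeroSum (sym n≡pn′) (sym (map-toℕ-scaled scaled))
              (unitZeroSum-*ˡ pr (weightedZeroSum⇒unitZeroSum zs′)))

  weightedZeroSum-unscale : Pointwise (ScaledBy p) ys ys′ → WeightedZeroSum (U n) ys → WeightedZeroSum (U n′) ys′
  weightedZeroSum-unscale scaled zs@(ys≢[] , _) =
    unitZeroSum⇒weightedZeroSum (Pointwise-≢[] scaled ys≢[])
      (unitZeroSum-*ˡ⁻ (subst₂ UnitZeroSum n≡pn′ (map-toℕ-scaled scaled) (weightedZeroSum⇒unitZeroSum zs)))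

  zeroSumFree-unscale : Pointwise (ScaledBy p) xs xs′ → ZeroSumFree n xs → ZeroSumFree n′ xs′
  zeroSumFree-unscale scaled free (ys′ , block′ , zs′) with Block-Pointwise (Pointwise.symmetric sym scaled) block′
  ... | ys , ys′∼ys , block = free (ys , block , weightedZeroSum-scale (Pointwise.symmetric sym ys′∼ys) zs′)

  scale : Fin n′ → Fin n
  scale y′ = fromℕ< (subst (p * toℕ y′ <_) (sym n≡pn′) (*-monoʳ-< p (toℕ<n y′)))

  scale-scaledBy : ∀ xs′ → Pointwise (ScaledBy p) (map scale xs′) xs′
  scale-scaledBy []        = []
  scale-scaledBy (y′ ∷ xs′) = toℕ-fromℕ< _ ∷ scale-scaledBy xs′

  zeroSumFree-scale : ∀ xs′ → ZeroSumFree n′ xs′ → ZeroSumFree n (map scale xs′)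
  zeroSumFree-scale xs′ free′ (ys , block , zs) with Block-Pointwise (scale-scaledBy xs′) block
  ... | ys′ , ys∼ys′ , block′ = free′ (ys′ , block′ , weightedZeroSum-unscale ys∼ys′ zs)

  all-∣-scaled : Pointwise (ScaledBy p) xs xs′ → All (λ y → p ∣ toℕ y) xs
  all-∣-scaled []                          = []
  all-∣-scaled {xs′ = y′ ∷ _} (y≡py′ ∷ scaled) = divides (toℕ y′) (trans y≡py′ (*-comm p _)) ∷ all-∣-scaled scaled

  allHaveBlock-unscale : ∀ {c k} → c ≤ k + suc k → AllHaveBlock n (U n) c → AllHaveBlock n′ (U n′) k
  allHaveBlock-unscale {c} {k} c≤2k+1 allHave T ∣T∣≡k with hasZeroSumBlock? T
  ... | yes block = block
  ... | no free′ = ⊥-elim (zeroSumFree⇒¬AllHaveBlock (pT ++ one ∷ pT) free c≤∣Z∣ allHave)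
    where
    pT = map scale T
    one : Fin n
    one = fromℕ< 1<n
    p∣pT = all-∣-scaled (scale-scaledBy T)
    free : ZeroSumFree n (pT ++ one ∷ pT)
    free = zeroSumFree-separated (divides n′ (trans n≡pn′ (*-comm p n′))) pT one pT
             (zeroSumFree-scale T free′) (zeroSumFree-scale T free′) p∣pT p∣pT
             (prime∤fromℕ<-1 pr 1<n)
    ∣pT∣≡k : length pT ≡ k
    ∣pT∣≡k = trans (length-map scale T) ∣T∣≡k
    c≤∣Z∣ : c ≤ length (pT ++ one ∷ pT)
    c≤∣Z∣ = subst (c ≤_) (sym (trans (length-++ pT) (cong₂ (λ a b → a + suc b) ∣pT∣≡k ∣pT∣≡k))) c≤2k+1

  extremal-unscale : ∀ {k} → AllHaveBlock n (U n) (2 * suc k) → (xs : List (Fin n)) {xs′ : List (Fin n′)}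
                   → ZeroSumFree n xs → length xs ≡ k → Pointwise (ScaledBy p) xs xs′ → Extremal n′ (U n′) xs′
  extremal-unscale {k} allHave xs {xs′} free ∣xs∣≡k scaled =
    zeroSumFree⇒extremal xs′
      (subst (AllHaveBlock n′ (U n′) ∘ suc) (sym ∣xs′∣≡k) (allHaveBlock-unscale 2k+2≤2k+3 allHave))
      (zeroSumFree-unscale scaled free)
    where
    ∣xs′∣≡k : length xs′ ≡ k
    ∣xs′∣≡k = trans (sym (Pointwise-length scaled)) ∣xs∣≡k
    2k+2≤2k+3 : 2 * suc k ≤ suc k + suc (suc k)
    2k+2≤2k+3 = +-monoʳ-≤ (suc k) (≤-trans (≤-reflexive (+-identityʳ (suc k))) (n≤1+n (suc k)))

maximal-zeroSumFree⇒¬All-∣ : ∀ {n p} → Prime p → p ∣ n → (1<n : 1 < n) → (S : List (Fin n))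
  → AllHaveBlock n (U n) (suc (length S)) → ZeroSumFree n S → ¬ All (λ y → p ∣ toℕ y) S
maximal-zeroSumFree⇒¬All-∣ pr p∣n 1<n S allHave free p∣S =
  zeroSumFree⇒¬AllHaveBlock (S ++ fromℕ< 1<n ∷ [])
    (zeroSumFree-separated p∣n S (fromℕ< 1<n) [] free zeroSumFree-[] p∣S [] (prime∤fromℕ<-1 pr 1<n))
    (≤-reflexive (trans (+-comm 1 (length S)) (sym (length-++ S)))) allHave

separated-length-≤ : ∀ {n q k} → q ∣ n → AllHaveBlock n (U n) (2 * suc k) → (A : List (Fin n)) (t : Fin n)
  → ZeroSumFree n A → All (λ y → q ∣ toℕ y) A → ¬ q ∣ toℕ t → length A ≤ k
separated-length-≤ {k = k} q∣n allHave A t free q∣A q∤t = ≮⇒≥ λ k<∣A∣ →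
  zeroSumFree⇒¬AllHaveBlock (A ++ t ∷ A) (zeroSumFree-separated q∣n A t A free free q∣A q∣A q∤t)
    (subst (2 * suc k ≤_) (sym (length-++ A))
           (+-mono-≤ k<∣A∣ (≤-trans (≤-reflexive (+-identityʳ _)) (m≤n⇒m≤1+n k<∣A∣))))
    allHave

separation-toℕ⁻ : ∀ {n} (S : List (Fin n)) → Separation n (map toℕ S)
  → ∃[ q ] ∃[ A ] ∃[ t ] ∃[ B ] (S ≡ A ++ t ∷ B × q ∣ n × ¬ q ∣ toℕ t
                                 × All (λ y → q ∣ toℕ y) A × All (λ y → q ∣ toℕ y) B)
separation-toℕ⁻ S record { q = q ; q∣n = q∣n ; split = split ; q∤pivot = q∤t ; q∣before = q∣A ; q∣after = q∣B }
  with map-≡-++-∷⁻ toℕ S split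
... | A , t , B , S≡ , refl , refl , refl = q , A , t , B , S≡ , q∣n , q∤t , All.map⁻ q∣A , All.map⁻ q∣B

separation-middle : ∀ {n k} .{{_ : NonZero n}} → ¬ 2 ∣ n → AllHaveBlock n (U n) (2 * suc k)
  → (S₁ : List (Fin n)) (x : Fin n) (S₂ : List (Fin n)) → ZeroSumFree n (S₁ ++ x ∷ S₂)
  → length S₁ ≡ k → suc (length (S₁ ++ x ∷ S₂)) ≡ 2 * suc k
  → ∃[ q ] (q ∣ n × ¬ q ∣ toℕ x × All (λ y → q ∣ toℕ y) S₁ × All (λ y → q ∣ toℕ y) S₂)
separation-middle {n} {k} 2∤n allHave S₁ x S₂ free ∣S₁∣≡k ∣S∣+1≡2k+2
  with unitZeroSum⊎separation n 2∤n (map toℕ (S₁ ++ x ∷ S₂))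
... | inj₁ zs = ⊥-elim (free (_ , Block-refl S≢[] , unitZeroSum⇒weightedZeroSum S≢[] zs))
  where
  S≢[] : S₁ ++ x ∷ S₂ ≢ []
  S≢[] eq with ++-conicalʳ S₁ (x ∷ S₂) eq
  ... | ()
... | inj₂ sep with separation-toℕ⁻ (S₁ ++ x ∷ S₂) sep
... | q , A , t , B , S≡ , q∣n , q∤t , q∣A , q∣B =
  middle (++-cancel-length S₁ A (trans ∣S₁∣≡k (sym ∣A∣≡k)) S≡)
  where
  free′ : ZeroSumFree n (A ++ t ∷ B)
  free′ = subst (ZeroSumFree n) S≡ free
  ∣A∣≡k : length A ≡ k
  ∣A∣≡k = middle-index
    (separated-length-≤ q∣n allHave A t (zeroSumFree-++⁻ˡ A free′) q∣A q∤t)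
    (separated-length-≤ q∣n allHave B t (zeroSumFree-++⁻ʳ (t ∷ []) (zeroSumFree-++⁻ʳ A free′)) q∣B q∤t)
    (trans (cong suc (sym (trans (cong length S≡) (length-++ A)))) ∣S∣+1≡2k+2)
  middle : S₁ ≡ A × x ∷ S₂ ≡ t ∷ B
         → ∃[ q ] (q ∣ n × ¬ q ∣ toℕ x × All (λ y → q ∣ toℕ y) S₁ × All (λ y → q ∣ toℕ y) S₂)
  middle (refl , refl) = q , q∣n , q∤t , q∣A , q∣B

mainTheorem2 : (n : ℕ) → ¬ (2 ∣ n) → 1 < n →
    (S : List (Fin n)) → Extremal n (U n) S →
    (k : ℕ) → suc (length S) ≡ 2 * suc k →
    (S₁ : List (Fin n)) (x : Fin n) (S₂ : List (Fin n)) →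
    S ≡ S₁ ++ x ∷ S₂ → length S₁ ≡ k →
    ∃[ p ] (Prime p × p ∣ n
      × All (λ y → p ∣ toℕ y) S₁ × All (λ y → p ∣ toℕ y) S₂ × ¬ (p ∣ toℕ x)
      × ((n′ : ℕ) → n ≡ p * n′ → (S₁′ S₂′ : List (Fin n′))
          → Pointwise (λ y y′ → toℕ y ≡ p * toℕ y′) S₁ S₁′
          → Pointwise (λ y y′ → toℕ y ≡ p * toℕ y′) S₂ S₂′
          → Extremal n′ (U n′) S₁′ × Extremal n′ (U n′) S₂′))
mainTheorem2 n 2∤n 1<n S extremal@(_ , _ , free) k ∣S∣+1≡2k+2 S₁ x S₂ refl ∣S₁∣≡k
  with subst (AllHaveBlock n (U n)) ∣S∣+1≡2k+2 (extremal⇒allHaveBlock S extremal)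
... | allHave with separation-middle {{>-nonZero (<⇒≤ 1<n)}} 2∤n allHave S₁ x S₂ free ∣S₁∣≡k ∣S∣+1≡2k+2
... | q , q∣n , q∤x , q∣S₁ , q∣S₂ with ∃-prime-divisor q (λ { refl → q∤x (1∣ _) })
... | p , pr , p∣q = p , pr , p∣n , p∣S₁ , p∣S₂ , p∤x , λ n′ n≡pn′ S₁′ S₂′ S₁≈pS₁′ S₂≈pS₂′ →
  extremal-unscale pr n≡pn′ 1<n allHave S₁ (zeroSumFree-++⁻ˡ S₁ free) ∣S₁∣≡k S₁≈pS₁′ ,
  extremal-unscale pr n≡pn′ 1<n allHave S₂ (zeroSumFree-++⁻ʳ (x ∷ []) (zeroSumFree-++⁻ʳ S₁ free))
                   (other-half ∣S₁∣≡k (trans (cong suc (sym (length-++ S₁))) ∣S∣+1≡2k+2)) S₂≈pS₂′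
  where
  p∣n = ∣-trans p∣q q∣n
  p∣S₁ = All.map (∣-trans p∣q) q∣S₁
  p∣S₂ = All.map (∣-trans p∣q) q∣S₂
  p∤x : ¬ p ∣ toℕ x
  p∤x p∣x = maximal-zeroSumFree⇒¬All-∣ pr p∣n 1<n (S₁ ++ x ∷ S₂) (extremal⇒allHaveBlock S extremal) free
              (All.++⁺ p∣S₁ (p∣x ∷ p∣S₂))
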